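{- A connected graph $G$ with no isolated vertices is $\gamma_{tR}$-ER-critical if and only if there exist an integer $n\geq 1$ and integers $k_1\geq k_2\geq\dots\geq k_n\geq 0$ with $k_i\neq 1$ for all $1\leq i\leq n$ such that $G$ is isomorphic to the graph obtained from the star $K_{1,n}$ by attaching $k_i$ new pendant vertices to the $i$-th leaf of the star, for each $1\leq i\leq n$.
   Context: All graphs are finite and simple. A total Roman dominating function (TRD-function) on a graph $G$ with no isolated vertices is a function $f:V(G)\to\{0,1,2\}$ such that every vertex $v$ with $f(v)=0$ is adjacent to some $u$ with $f(u)=2$, and the subgraph induced by $\{w:f(w)>0\}$ has no isolated vertices; its weight is $\sum_v f(v)$ and $\gamma_{tR}(G)$ is the minimum weight. For an edge $e$ incident with a vertex of degree $1$, define $\gamma_{tR}(G-e)=\infty$. A graph $G$ with no isolated vertices is $\gamma_{tR}$-ER-critical if $\gamma_{tR}(G-e)>\gamma_{tR}(G)$ for every edge $e\in E(G)$. (When $n=1$, either vertex of $K_{1,1}$ may be regarded as the centre.) -}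

module Defs where

open import Data.Nat using (ℕ; zero; suc; _+_; _≤_; _<_)
open import Data.Fin using (Fin; toℕ; _≟_)
import Data.Fin as F
open import Data.Bool using (Bool; true; false; _∧_; _∨_; not; if_then_else_)
open import Data.List using (List; map; allFin)
open import Data.Nat.ListAction using (sum)
open import Data.Product using (Σ; ∃; ∃-syntax; _×_; _,_)
open import Data.Sum using (_⊎_)
open import Relation.Nullary.Decidable using (⌊_⌋)
open import Relation.Binary.PropositionalEquality using (_≡_)
open import Relation.Binary.Construct.Closure.ReflexiveTransitive using (Star)
open import Function.Bundles using (_↔_; Inverse)

Adj : ℕ → Set
Adj n = Fin n → Fin n → Bool

record Graph : Set where
  field
    V      : ℕ
    adj    : Adj V
    sym    : ∀ u v → adj u v ≡ adj v u
    irrefl : ∀ v → adj v v ≡ false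
open Graph public

degree : ∀ {n} → Adj n → Fin n → ℕ
degree {n} a v = sum (map (λ u → if a v u then 1 else 0) (allFin n))

NoIsolated : ∀ {n} → Adj n → Set
NoIsolated {n} a = ∀ (v : Fin n) → ∃[ u ] (a v u ≡ true)

Connected : ∀ {n} → Adj n → Set
Connected {n} a = ∀ (u v : Fin n) → Star (λ x y → a x y ≡ true) u v

removeEdge : ∀ {n} → Adj n → Fin n → Fin n → Adj n
removeEdge a u v x y =
  a x y ∧ not ((⌊ x ≟ u ⌋ ∧ ⌊ y ≟ v ⌋) ∨ (⌊ x ≟ v ⌋ ∧ ⌊ y ≟ u ⌋))

weight : ∀ {n} → (Fin n → Fin 3) → ℕ
weight {n} f = sum (map (λ v → toℕ (f v)) (allFin n))

IsTRDF : ∀ {n} → Adj n → (Fin n → Fin 3) → Set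
IsTRDF {n} a f =
  (∀ (v : Fin n) → toℕ (f v) ≡ 0 → ∃[ u ] (a v u ≡ true × toℕ (f u) ≡ 2))
  × (∀ (v : Fin n) → 0 < toℕ (f v) → ∃[ u ] (a v u ≡ true × 0 < toℕ (f u)))

IsγtR : ∀ {n} → Adj n → ℕ → Set
IsγtR a k = (∃[ f ] (IsTRDF a f × weight f ≡ k))
          × (∀ f → IsTRDF a f → k ≤ weight f)

-- γ_tR-ER-critical: for every edge e = uv, either e is incident with a vertex
-- of degree 1 (so γ_tR(G - e) = ∞ > γ_tR(G)), or γ_tR(G - e) > γ_tR(G).
ERCritical : Graph → Set
ERCritical G = ∀ (u v : Fin (V G)) → adj G u v ≡ true →
  (degree (adj G) u ≡ 1 ⊎ degree (adj G) v ≡ 1)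
  ⊎ (∀ k k' → IsγtR (adj G) k → IsγtR (removeEdge (adj G) u v) k' → k < k')

data SpV (n : ℕ) (k : Fin n → ℕ) : Set where
  centre  : SpV n k
  leaf    : Fin n → SpV n k
  pendant : (i : Fin n) → Fin (k i) → SpV n k

data SpAdj {n : ℕ} {k : Fin n → ℕ} : SpV n k → SpV n k → Set where
  c-l : ∀ i → SpAdj centre (leaf i)
  l-c : ∀ i → SpAdj (leaf i) centre
  l-p : ∀ i j → SpAdj (leaf i) (pendant i j)
  p-l : ∀ i j → SpAdj (pendant i j) (leaf i)

IsoSpider : (G : Graph) (n : ℕ) (k : Fin n → ℕ) → Set
IsoSpider G n k = Σ (Fin (V G) ↔ SpV n k) λ φ →
  ∀ (x y : Fin (V G)) →
    (adj G x y ≡ true → SpAdj (Inverse.to φ x) (Inverse.to φ y))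
    × (SpAdj (Inverse.to φ x) (Inverse.to φ y) → adj G x y ≡ true)

-- A minimum total Roman dominating function f of an ER-critical graph G has no redundant edge:
-- if both ends of an edge e stay dominated and paired without it, f is a total Roman dominating
-- function of G - e of weight γtR(G), contradicting criticality. Hence a vertex of value 0 has a
-- single neighbour, and of two adjacent positive vertices one has the other as its only positive
-- neighbour. From a positive vertex this produces a centre c whose neighbours are independent and
-- whose second neighbours are pendant. A neighbour of c with exactly one pendant, and likewise a
-- path p A B p′ in which A and B have no further neighbours, is excluded because turning the values
-- 2, 0 into 1, 1 gives a function of weight γtR(G) on G minus an edge. Connectivity makes G the
-- spider around c.
-- Conversely, in a spider the pendant edges and the legs without pendants are exempt, and once a
-- leg with k ≥ 2 pendants is cut off, every total Roman dominating function of the rest spends at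
-- least 3 on that leg; after moving a unit onto the centre if needed, putting 2 on the leaf and 0
-- on its pendants gives a strictly lighter one of the spider.

module Submission where

open import Defs renaming (sym to adj-sym)
open import Data.Nat using (ℕ; zero; suc; _+_; _≤_; _<_; z≤n; s≤s; _≟_)
open import Data.Nat.Properties
open import Data.Nat.Induction using (<-rec)
open import Data.Nat.ListAction using (sum)
open import Data.Fin using (Fin; toℕ; punchIn) renaming (_≟_ to _≟ᶠ_)
import Data.Fin as F
open import Data.Fin.Patterns using (0F; 1F; 2F)
open import Data.Fin.Properties using (punchInᵢ≢i; punchIn-punchOut; any?; all?; ¬∀⟶∃¬)
open import Data.Bool using (Bool; true; false; _∧_; not; if_then_else_)
open import Data.Bool.Properties using (∧-zeroʳ; ∨-zeroʳ) renaming (_≟_ to _≟ᵇ_)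
open import Data.Product using (Σ; ∃; ∃-syntax; _×_; _,_; proj₁; proj₂)
open import Data.Sum using (_⊎_; inj₁; inj₂)
open import Data.Empty using (⊥; ⊥-elim)
open import Data.Unit using (⊤; tt)
open import Function using (_∘_)
open import Function.Bundles using (_↔_; _⇔_; Inverse; mk↔ₛ′; mk⇔)
open import Relation.Nullary using (¬_; Dec; yes; no; contradiction; ¬?)
open import Relation.Nullary.Decidable using (⌊_⌋; _×-dec_; _→-dec_)
open import Relation.Binary.PropositionalEquality
open import Relation.Binary.Bundles using (DecTotalOrder)
import Relation.Binary.Construct.On as On
import Relation.Binary.Construct.Flip.EqAndOrd as Flip
open import Relation.Binary.Construct.Closure.ReflexiveTransitive using (Star; ε; _◅_)
open import Algebra.Properties.CommutativeSemigroup +-commutativeSemigroup using (xy∙z≈zy∙x)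
open import Data.Vec.Functional using (removeAt; updateAt; replicate) renaming (_∷_ to _◂_)
open import Data.Vec.Functional.Properties using (updateAt-updates; updateAt-minimal)
open import Algebra.Properties.CommutativeMonoid.Sum +-0-commutativeMonoid
  using (sum-cong-≗; sum-replicate-zero; sum-remove) renaming (sum to ∑)
open import Data.List using (List; []; _∷_; map; allFin; tabulate; length; filter; lookup)
open import Data.List.Properties using (map-tabulate)
open import Data.List.Relation.Unary.All as All using ()
open import Data.List.Relation.Unary.AllPairs using (_∷_)
open import Data.List.Relation.Unary.Any using (here; there; index)
open import Data.List.Relation.Unary.Any.Properties using (lookup-index)
open import Data.List.Membership.Propositional using (_∈_)
open import Data.List.Membership.Propositional.Properties using (∈-filter⁺; ∈-filter⁻; ∈-allFin; ∈-lookup)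
open import Data.List.Relation.Binary.Permutation.Propositional using (↭⇒↭ₛ; ↭-sym)
open import Data.List.Relation.Binary.Permutation.Propositional.Properties using (∈-resp-↭)
import Data.List.Relation.Binary.Permutation.Setoid.Properties as Permutationₛ
open import Data.List.Relation.Unary.Unique.Propositional using (Unique)
import Data.List.Relation.Unary.Unique.Propositional.Properties as Unique
import Data.List.Relation.Unary.Sorted.TotalOrder.Properties as Sorted
import Data.List.Sort as Sort

value-cases : ∀ (c : Fin 3) → toℕ c ≡ 0 ⊎ 0 < toℕ c
value-cases 0F        = inj₁ refl
value-cases (F.suc c) = inj₂ (s≤s z≤n)

≡2⇒>0 : ∀ {m} → m ≡ 2 → 0 < m
≡2⇒>0 refl = s≤s z≤n

≥2 : ∀ m → m ≢ 0 → m ≢ 1 → 2 ≤ m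
≥2 0             m≢0 _   = contradiction refl m≢0
≥2 1             _   m≢1 = contradiction refl m≢1
≥2 (suc (suc m)) _   _   = s≤s (s≤s z≤n)

value-cases₃ : ∀ (c : Fin 3) → toℕ c ≡ 0 ⊎ toℕ c ≡ 1 ⊎ toℕ c ≡ 2
value-cases₃ 0F = inj₁ refl
value-cases₃ 1F = inj₂ (inj₁ refl)
value-cases₃ 2F = inj₂ (inj₂ refl)

two-distinct : ∀ m → 2 ≤ m → Σ (Fin m) λ r₀ → Σ (Fin m) λ r₁ → r₀ ≢ r₁
two-distinct (suc (suc m)) _ = 0F , 1F , λ ()
two-distinct 1 (s≤s ())

¬∃-other⇒≡ : ∀ {n} {Q : Fin n → Set} y → ¬ (∃ λ z → z ≢ y × Q z) → ∀ z → Q z → z ≡ y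
¬∃-other⇒≡ y ¬other z qz with z ≟ᶠ y
... | yes z≡y = z≡y
... | no z≢y  = contradiction (z , z≢y , qz) ¬other

≢? : ∀ {n} (x y : Fin n) → Dec (x ≢ y)
≢? x y = ¬? (x ≟ᶠ y)

sum-allFin : ∀ {n} (h : Fin n → ℕ) → sum (map h (allFin n)) ≡ ∑ h
sum-allFin h = trans (cong sum (map-tabulate (λ i → i) h)) (sum-tabulate h)
  where
  sum-tabulate : ∀ {n} (h : Fin n → ℕ) → sum (tabulate h) ≡ ∑ h
  sum-tabulate {zero} h = refl
  sum-tabulate {suc n} h = cong (h F.zero +_) (sum-tabulate (h ∘ F.suc))

∑-mono-≤ : ∀ {n} {g h : Fin n → ℕ} → (∀ i → g i ≤ h i) → ∑ g ≤ ∑ h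
∑-mono-≤ {zero} _ = z≤n
∑-mono-≤ {suc n} g≤h = +-mono-≤ (g≤h F.zero) (∑-mono-≤ (g≤h ∘ F.suc))

∑-mono-< : ∀ {n} {g h : Fin n → ℕ} (i : Fin n) → (∀ j → g j ≤ h j) → g i < h i → ∑ g < ∑ h
∑-mono-< {suc n} {g} {h} i g≤h gi<hi = begin-strict
  ∑ g                     ≡⟨ sum-remove g ⟩
  g i + ∑ (removeAt g i)  <⟨ +-mono-<-≤ gi<hi (∑-mono-≤ (g≤h ∘ punchIn i)) ⟩
  h i + ∑ (removeAt h i)  ≡⟨ sum-remove h ⟨
  ∑ h                     ∎
  where open ≤-Reasoning

term≤∑ : ∀ {n} (h : Fin n → ℕ) (i : Fin n) → h i ≤ ∑ h
term≤∑ {suc n} h i = subst (h i ≤_) (sym (sum-remove h)) (m≤m+n (h i) _)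

∑-removeAt-cong : ∀ {n} (g h : Fin (suc n) → ℕ) (i : Fin (suc n)) →
  (∀ j → j ≢ i → g j ≡ h j) → ∑ (removeAt g i) ≡ ∑ (removeAt h i)
∑-removeAt-cong g h i g≡h = sum-cong-≗ (λ j → g≡h (punchIn i j) (punchInᵢ≢i i j))

indicator : Bool → ℕ
indicator b = if b then 1 else 0

degree≡∑ : ∀ {n} (a : Adj n) v → degree a v ≡ ∑ (λ u → indicator (a v u))
degree≡∑ a v = sum-allFin (λ u → indicator (a v u))

degree≡1 : ∀ {n} (a : Adj n) v w → a v w ≡ true → (∀ u → a v u ≡ true → u ≡ w) →
  degree a v ≡ 1
degree≡1 {suc n} a v w avw unique = begin
  degree a v                              ≡⟨ degree≡∑ a v ⟩
  ∑ t                                     ≡⟨ sum-remove t ⟩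
  t w + ∑ (removeAt t w)                  ≡⟨ cong₂ _+_ (cong indicator avw)
                                                       (∑-removeAt-cong t (λ _ → 0) w others) ⟩
  1 + ∑ (replicate n 0)                   ≡⟨ cong (1 +_) (sum-replicate-zero n) ⟩
  1                                       ∎
  where
  open ≡-Reasoning
  t = λ u → indicator (a v u)
  others : ∀ u → u ≢ w → t u ≡ 0
  others u u≢w with a v u in avu
  ... | true  = contradiction (unique u avu) u≢w
  ... | false = refl

degree≢1 : ∀ {n} (a : Adj n) v u w → a v u ≡ true → a v w ≡ true → u ≢ w → degree a v ≢ 1
degree≢1 {suc n} a v u w avu avw u≢w deg≡1 = <-irrefl (sym deg≡1) (begin-strict
  1                                        ≡⟨ cong indicator avu ⟨
  t u                                      <⟨ m<m+n (t u) (subst (_≤ ∑ (removeAt t u)) w-term (term≤∑ _ j)) ⟩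
  t u + ∑ (removeAt t u)                   ≡⟨ sum-remove t ⟨
  ∑ t                                      ≡⟨ degree≡∑ a v ⟨
  degree a v                               ∎)
  where
  open ≤-Reasoning
  t = λ x → indicator (a v x)
  j = F.punchOut u≢w
  w-term : t (punchIn u j) ≡ 1
  w-term = trans (cong t (punchIn-punchOut u≢w)) (cong indicator avw)

adj⇒≢ : (G : Graph) → ∀ {x y} → adj G x y ≡ true → x ≢ y
adj⇒≢ G {x} axy refl = contradiction (trans (sym axy) (irrefl G x)) λ ()

adj-flip : (G : Graph) → ∀ {x y} → adj G x y ≡ true → adj G y x ≡ true
adj-flip G {x} {y} axy = trans (adj-sym G y x) axy

infixl 6 _[_]≔_
_[_]≔_ : ∀ {n} → (Fin n → Fin 3) → Fin n → Fin 3 → Fin n → Fin 3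
f [ x ]≔ c = updateAt f x (λ _ → c)

[]≔-updates : ∀ {n} (f : Fin n → Fin 3) x c → (f [ x ]≔ c) x ≡ c
[]≔-updates f x c = updateAt-updates x f

[]≔-minimal : ∀ {n} (f : Fin n → Fin 3) {x} c v → v ≢ x → (f [ x ]≔ c) v ≡ f v
[]≔-minimal f c v v≢x = updateAt-minimal v _ f v≢x

weight≡∑ : ∀ {n} (f : Fin n → Fin 3) → weight f ≡ ∑ (toℕ ∘ f)
weight≡∑ f = sum-allFin (toℕ ∘ f)

weight-cong : ∀ {n} {f g : Fin n → Fin 3} → (∀ v → f v ≡ g v) → weight f ≡ weight g
weight-cong {f = f} {g} f≡g =
  trans (weight≡∑ f) (trans (sum-cong-≗ (cong toℕ ∘ f≡g)) (sym (weight≡∑ g)))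

weight-mono-< : ∀ {n} {f g : Fin n → Fin 3} x → (∀ v → f v F.≤ g v) → f x F.< g x →
  weight f < weight g
weight-mono-< {f = f} {g} x f≤g fx<gx =
  subst₂ _<_ (sym (weight≡∑ f)) (sym (weight≡∑ g)) (∑-mono-< x f≤g fx<gx)

weight-mono-<₂ : ∀ {n} {f g : Fin n → Fin 3} x y → x ≢ y → (∀ v → f v F.≤ g v) →
  f x F.< g x → f y F.< g y → suc (weight f) < weight g
weight-mono-<₂ {f = f} {g} x y x≢y f≤g fx<gx fy<gy =
  ≤-trans (s≤s (weight-mono-< y f≤h (subst (f y F.<_) (sym ([]≔-updates f y (g y))) fy<gy)))
          (weight-mono-< x h≤g (subst (F._< g x) (sym ([]≔-minimal f (g y) x x≢y)) fx<gx))
  where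
  h = f [ y ]≔ g y
  f≤h : ∀ v → f v F.≤ h v
  f≤h v with v ≟ᶠ y
  ... | yes refl = subst (f v F.≤_) (sym ([]≔-updates f v (g v))) (f≤g v)
  ... | no v≢y   = subst (f v F.≤_) (sym ([]≔-minimal f (g y) v v≢y)) ≤-refl
  h≤g : ∀ v → h v F.≤ g v
  h≤g v with v ≟ᶠ y
  ... | yes refl = subst (F._≤ g v) (sym ([]≔-updates f v (g v))) ≤-refl
  ... | no v≢y   = subst (F._≤ g v) (sym ([]≔-minimal f (g y) v v≢y)) (f≤g v)

weight-split : ∀ {n} (f : Fin (suc n) → Fin 3) x → weight f ≡ toℕ (f x) + ∑ (removeAt (toℕ ∘ f) x)
weight-split f x = trans (weight≡∑ f) (sum-remove (toℕ ∘ f))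

weight-[]≔ : ∀ {n} (f : Fin n → Fin 3) x c → weight (f [ x ]≔ c) + toℕ (f x) ≡ weight f + toℕ c
weight-[]≔ {suc n} f x c = begin
  weight (f [ x ]≔ c) + toℕ (f x)                       ≡⟨ cong (_+ toℕ (f x)) (weight-split (f [ x ]≔ c) x) ⟩
  toℕ ((f [ x ]≔ c) x) + ∑ (removeAt h x) + toℕ (f x)   ≡⟨ cong₂ (λ d s → toℕ d + s + toℕ (f x))
                                                             ([]≔-updates f x c) (∑-removeAt-cong _ _ x unchanged) ⟩
  toℕ c + ∑ (removeAt (toℕ ∘ f) x) + toℕ (f x)          ≡⟨ xy∙z≈zy∙x (toℕ c) _ (toℕ (f x)) ⟩
  toℕ (f x) + ∑ (removeAt (toℕ ∘ f) x) + toℕ c          ≡⟨ cong (_+ toℕ c) (weight-split f x) ⟨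
  weight f + toℕ c                                      ∎
  where
  open ≡-Reasoning
  h = toℕ ∘ (f [ x ]≔ c)
  unchanged : ∀ v → v ≢ x → h v ≡ toℕ (f v)
  unchanged v v≢x = cong toℕ ([]≔-minimal f c v v≢x)

level : ∀ {n} → (Fin n → Fin 3) → Fin n → Fin n → Fin n → Fin 3
level f x p = f [ x ]≔ 1F [ p ]≔ 1F

level-elsewhere : ∀ {n} (f : Fin n → Fin 3) {x p} v → v ≢ x → v ≢ p → level f x p v ≡ f v
level-elsewhere f v v≢x v≢p = trans ([]≔-minimal _ 1F v v≢p) ([]≔-minimal f 1F v v≢x)

[]≔1-positive : ∀ {n} (f : Fin n → Fin 3) x v → 0 < toℕ (f v) → 0 < toℕ ((f [ x ]≔ 1F) v)
[]≔1-positive f x v fv>0 with v ≟ᶠ x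
... | yes refl = subst (λ c → 0 < toℕ c) (sym ([]≔-updates f x 1F)) (s≤s z≤n)
... | no v≢x   = subst (λ c → 0 < toℕ c) (sym ([]≔-minimal f 1F v v≢x)) fv>0

level-positive : ∀ {n} (f : Fin n → Fin 3) x p v → 0 < toℕ (f v) → 0 < toℕ (level f x p v)
level-positive f x p v = []≔1-positive _ p v ∘ []≔1-positive f x v

level-positiveˡ : ∀ {n} (f : Fin n → Fin 3) x p → 0 < toℕ (level f x p x)
level-positiveˡ f x p =
  []≔1-positive _ p x (subst (λ c → 0 < toℕ c) (sym ([]≔-updates f x 1F)) (s≤s z≤n))

level-positiveʳ : ∀ {n} (f : Fin n → Fin 3) x p → 0 < toℕ (level f x p p)
level-positiveʳ f x p = subst (λ c → 0 < toℕ c) (sym ([]≔-updates _ p 1F)) (s≤s z≤n)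

level-zero : ∀ {n} (f : Fin n → Fin 3) {x p} v → toℕ (level f x p v) ≡ 0 → v ≢ x × v ≢ p
level-zero f {x} {p} v hv≡0 =
    (λ { refl → <-irrefl (sym hv≡0) (level-positiveˡ f x p) })
  , (λ { refl → <-irrefl (sym hv≡0) (level-positiveʳ f x p) })

weight-level : ∀ {n} (f : Fin n → Fin 3) x p → toℕ (f x) ≡ 2 → toℕ (f p) ≡ 0 → p ≢ x →
  weight (level f x p) ≡ weight f
weight-level {suc n} f x p fx≡2 fp≡0 p≢x = begin
  weight (g [ p ]≔ 1F)                   ≡⟨ +-identityʳ _ ⟨
  weight (g [ p ]≔ 1F) + 0               ≡⟨ cong (weight (g [ p ]≔ 1F) +_) gp≡0 ⟨
  weight (g [ p ]≔ 1F) + toℕ (g p)       ≡⟨ weight-[]≔ g p 1F ⟩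
  weight g + 1                           ≡⟨ +-cancelʳ-≡ 1 _ _ (begin
    weight g + 1 + 1                       ≡⟨ +-assoc (weight g) 1 1 ⟩
    weight g + 2                           ≡⟨ cong (weight g +_) fx≡2 ⟨
    weight g + toℕ (f x)                   ≡⟨ weight-[]≔ f x 1F ⟩
    weight f + 1                           ∎) ⟩
  weight f                               ∎
  where
  open ≡-Reasoning
  g = f [ x ]≔ 1F
  gp≡0 : toℕ (g p) ≡ 0
  gp≡0 = trans (cong toℕ ([]≔-minimal f 1F p p≢x)) fp≡0

≟-pair-false : ∀ {n} (x u y v : Fin n) → ¬ (x ≡ u × y ≡ v) →
  (⌊ x ≟ᶠ u ⌋ ∧ ⌊ y ≟ᶠ v ⌋) ≡ false
≟-pair-false x u y v ¬xy with x ≟ᶠ u | y ≟ᶠ v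
... | yes x≡u | yes y≡v = contradiction (x≡u , y≡v) ¬xy
... | yes _   | no _    = refl
... | no _    | _       = refl

module _ {n} (a : Adj n) (u v : Fin n) where

  removeEdge-⊆ : ∀ x y → removeEdge a u v x y ≡ true → a x y ≡ true
  removeEdge-⊆ x y e with a x y
  ... | true  = refl
  ... | false = e

  removeEdge-removes : removeEdge a u v u v ≡ false
  removeEdge-removes with u ≟ᶠ u | v ≟ᶠ v
  ... | yes _ | yes _  = ∧-zeroʳ (a u v)
  ... | no u≢u | _     = contradiction refl u≢u
  ... | yes _ | no v≢v = contradiction refl v≢v

  removeEdge-removes⁻ : removeEdge a u v v u ≡ false
  removeEdge-removes⁻ with v ≟ᶠ v | u ≟ᶠ u
  ... | yes _ | yes _  = subst (λ b → a v u ∧ not b ≡ false) (sym (∨-zeroʳ _)) (∧-zeroʳ (a v u))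
  ... | no v≢v | _     = contradiction refl v≢v
  ... | yes _ | no u≢u = contradiction refl u≢u

  removeEdge-keeps : ∀ x y → a x y ≡ true → ¬ (x ≡ u × y ≡ v) → ¬ (x ≡ v × y ≡ u) →
    removeEdge a u v x y ≡ true
  removeEdge-keeps x y axy ¬uv ¬vu
    rewrite axy | ≟-pair-false x u y v ¬uv | ≟-pair-false x v y u ¬vu = refl

  removeEdge-sym : (∀ x y → a x y ≡ a y x) →
    ∀ {x y} → removeEdge a u v x y ≡ true → removeEdge a u v y x ≡ true
  removeEdge-sym a-sym {x} {y} e = removeEdge-keeps y x (trans (a-sym y x) (removeEdge-⊆ x y e))
    (λ (y≡u , x≡v) → removed x≡v y≡u removeEdge-removes⁻)
    (λ (y≡v , x≡u) → removed x≡u y≡v removeEdge-removes)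
    where
    removed : ∀ {s t} → x ≡ s → y ≡ t → removeEdge a u v s t ≡ false → ⊥
    removed refl refl e′ with trans (sym e) e′
    ... | ()

  removeEdge-keeps-off : ∀ x y → a x y ≡ true → x ≢ u → x ≢ v → removeEdge a u v x y ≡ true
  removeEdge-keeps-off x y axy x≢u x≢v = removeEdge-keeps x y axy (x≢u ∘ proj₁) (x≢v ∘ proj₁)

-- Existence of a minimum total Roman dominating function

IsTRDF-cong : ∀ {n} {a : Adj n} {f g : Fin n → Fin 3} → (∀ v → f v ≡ g v) → IsTRDF a f → IsTRDF a g
IsTRDF-cong f≡g (dominated , paired) =
  (λ v gv≡0 → let (u , avu , fu≡2) = dominated v (trans (cong toℕ (f≡g v)) gv≡0)
              in u , avu , trans (cong toℕ (sym (f≡g u))) fu≡2)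
  , (λ v gv>0 → let (u , avu , fu>0) = paired v (subst (λ c → 0 < toℕ c) (sym (f≡g v)) gv>0)
                in u , avu , subst (λ c → 0 < toℕ c) (f≡g u) fu>0)

IsTRDF? : ∀ {n} (a : Adj n) f → Dec (IsTRDF a f)
IsTRDF? a f =
  all? (λ v → (toℕ (f v) ≟ 0) →-dec any? (λ u → (a v u ≟ᵇ true) ×-dec (toℕ (f u) ≟ 2)))
  ×-dec all? (λ v → (0 <? toℕ (f v)) →-dec any? (λ u → (a v u ≟ᵇ true) ×-dec (0 <? toℕ (f u))))

Extensional : ∀ {n m} → ((Fin n → Fin m) → Set) → Set
Extensional P = ∀ {f g} → (∀ i → f i ≡ g i) → P f → P g

◂-cong : ∀ {n m} {c : Fin m} {g h : Fin n → Fin m} → (∀ i → g i ≡ h i) →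
  ∀ i → (c ◂ g) i ≡ (c ◂ h) i
◂-cong g≡h F.zero    = refl
◂-cong g≡h (F.suc i) = g≡h i

◂-η : ∀ {n m} {f : Fin (suc n) → Fin m} i → f i ≡ (f F.zero ◂ (f ∘ F.suc)) i
◂-η F.zero    = refl
◂-η (F.suc i) = refl

∃-function? : ∀ {n m} (P : (Fin n → Fin m) → Set) → (∀ f → Dec (P f)) → Extensional P → Dec (∃ P)
∃-function? {zero} P P? P-ext with P? (λ ())
... | yes p = yes (_ , p)
... | no ¬p = no λ (f , pf) → ¬p (P-ext (λ ()) pf)
∃-function? {suc n} P P? P-ext
  with any? (λ c → ∃-function? (P ∘ (c ◂_)) (P? ∘ (c ◂_)) (P-ext ∘ ◂-cong))
... | yes (c , g , p) = yes (c ◂ g , p)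
... | no ¬p = no λ (f , pf) → ¬p (f F.zero , f ∘ F.suc , P-ext ◂-η pf)

minimum-weight : ∀ {n} (P : (Fin n → Fin 3) → Set) → (∀ f → Dec (P f)) → Extensional P →
  ∃ P → ∃ λ f → P f × (∀ g → P g → weight f ≤ weight g)
minimum-weight {n} P P? P-ext (f₀ , pf₀) = <-rec Minimum descend (weight f₀) f₀ pf₀ refl
  where
  Minimum : ℕ → Set
  Minimum m = ∀ f → P f → weight f ≡ m → ∃ λ f → P f × (∀ g → P g → weight f ≤ weight g)
  Lighter : ℕ → (Fin n → Fin 3) → Set
  Lighter m g = P g × weight g < m
  descend : ∀ m → (∀ {m′} → m′ < m → Minimum m′) → Minimum m
  descend m rec f pf refl
    with ∃-function? (Lighter m) (λ g → P? g ×-dec (weight g <? m))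
                     (λ f≡g (pf , lt) → P-ext f≡g pf , subst (_< m) (weight-cong f≡g) lt)
  ... | yes (g , pg , lt) = rec lt g pg refl
  ... | no ¬lighter = f , pf , λ g pg → ≮⇒≥ (λ lt → ¬lighter (g , pg , lt))

γtR-exists : ∀ {n} (a : Adj n) → NoIsolated a → ∃ (IsγtR a)
γtR-exists a noIsolated =
  let (f , tf , minimal) = minimum-weight (IsTRDF a) (IsTRDF? a) IsTRDF-cong ((λ _ → 1F) , all-ones)
  in weight f , (f , tf , refl) , minimal
  where
  all-ones : IsTRDF a (λ _ → 1F)
  all-ones = (λ _ ()) , λ v _ → let (u , avu) = noIsolated v in u , avu , s≤s z≤n

-- Edges that a total Roman dominating function does not need

OtherNeighbour : ∀ {n} → Adj n → Fin n → Fin n → Set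
OtherNeighbour a x y = ∃ λ z → z ≢ y × a x z ≡ true

ServedWithout : ∀ {n} → Adj n → (Fin n → Fin 3) → Fin n → Fin n → Set
ServedWithout a f x y =
  (toℕ (f x) ≡ 0 → ∃ λ z → z ≢ y × a x z ≡ true × toℕ (f z) ≡ 2)
  × (0 < toℕ (f x) → ∃ λ z → z ≢ y × a x z ≡ true × 0 < toℕ (f z))

module _ {n} {a : Adj n} {u v : Fin n} where

  reroute : ∀ {R : Fin n → Set} x → (∃ λ z → a x z ≡ true × R z) →
    (x ≡ u → ∃ λ z → z ≢ v × a x z ≡ true × R z) →
    (x ≡ v → ∃ λ z → z ≢ u × a x z ≡ true × R z) →
    ∃ λ z → removeEdge a u v x z ≡ true × R z
  reroute {R} x served at-u at-v = by-cases (x ≟ᶠ u) (x ≟ᶠ v)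
    where
    by-cases : Dec (x ≡ u) → Dec (x ≡ v) → ∃ λ z → removeEdge a u v x z ≡ true × R z
    by-cases (yes x≡u) _ =
      let (z , z≢v , axz , rz) = at-u x≡u
      in z , removeEdge-keeps a u v x z axz (z≢v ∘ proj₂)
               (λ (x≡v , z≡u) → z≢v (trans z≡u (trans (sym x≡u) x≡v))) , rz
    by-cases (no _) (yes x≡v) =
      let (z , z≢u , axz , rz) = at-v x≡v
      in z , removeEdge-keeps a u v x z axz
               (λ (x≡u , z≡v) → z≢u (trans z≡v (trans (sym x≡v) x≡u))) (z≢u ∘ proj₂) , rz
    by-cases (no x≢u) (no x≢v) =
      let (z , axz , rz) = served
      in z , removeEdge-keeps-off a u v x z axz x≢u x≢v , rz

  IsTRDF-removeEdge : ∀ {f} → IsTRDF a f → ServedWithout a f u v → ServedWithout a f v u →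
    IsTRDF (removeEdge a u v) f
  IsTRDF-removeEdge (dominated , paired) (u-dom , u-pair) (v-dom , v-pair) =
    (λ x fx≡0 → reroute x (dominated x fx≡0) (λ { refl → u-dom fx≡0 }) (λ { refl → v-dom fx≡0 }))
    , (λ x fx>0 → reroute x (paired x fx>0) (λ { refl → u-pair fx>0 }) (λ { refl → v-pair fx>0 }))

  removeEdge-NoIsolated : NoIsolated a → OtherNeighbour a u v → OtherNeighbour a v u →
    NoIsolated (removeEdge a u v)
  removeEdge-NoIsolated noIsolated (u′ , u′≢v , auu′) (v′ , v′≢u , avv′) x =
    let (y , axy) = noIsolated x
        (y′ , a′xy′ , _) = reroute {R = λ _ → ⊤} x (y , axy , tt)
                             (λ { refl → u′ , u′≢v , auu′ , tt }) (λ { refl → v′ , v′≢u , avv′ , tt })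
    in y′ , a′xy′

module Serving {n} (a : Adj n) (f : Fin n → Fin 3) where

  ServedWithout⇒OtherNeighbour : ∀ {x y} → ServedWithout a f x y → OtherNeighbour a x y
  ServedWithout⇒OtherNeighbour {x} (dom , pair) with value-cases (f x)
  ... | inj₁ fx≡0 = let (z , z≢y , axz , _) = dom fx≡0 in z , z≢y , axz
  ... | inj₂ fx>0 = let (z , z≢y , axz , _) = pair fx>0 in z , z≢y , axz

  served-by-two : ∀ {x y z} → toℕ (f x) ≡ 0 → z ≢ y → a x z ≡ true → toℕ (f z) ≡ 2 →
    ServedWithout a f x y
  served-by-two fx≡0 z≢y axz fz≡2 =
    (λ _ → _ , z≢y , axz , fz≡2) , λ fx>0 → contradiction fx>0 (<-irrefl (sym fx≡0))

  served-by-positive : ∀ {x y z} → 0 < toℕ (f x) → z ≢ y → a x z ≡ true → 0 < toℕ (f z) →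
    ServedWithout a f x y
  served-by-positive fx>0 z≢y axz fz>0 =
    (λ fx≡0 → contradiction fx>0 (<-irrefl (sym fx≡0))) , λ _ → _ , z≢y , axz , fz>0

  -- A vertex of value 0 never dominates or pairs anything.
  served-avoiding-zero : ∀ {u} → IsTRDF a f → toℕ (f u) ≡ 0 → ∀ x → ServedWithout a f x u
  served-avoiding-zero (dom , pair) fu≡0 x =
    (λ fx≡0 → let (z , axz , fz≡2) = dom x fx≡0
              in z , (λ { refl → <-irrefl (sym fu≡0) (≡2⇒>0 fz≡2) }) , axz , fz≡2)
    , (λ fx>0 → let (z , axz , fz>0) = pair x fx>0
                in z , (λ { refl → <-irrefl (sym fu≡0) fz>0 }) , axz , fz>0)

ERCritical⇒γtR<weight : (G : Graph) → NoIsolated (adj G) → ERCritical G →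
  ∀ {k u v h} → IsγtR (adj G) k → adj G u v ≡ true →
  OtherNeighbour (adj G) u v → OtherNeighbour (adj G) v u →
  IsTRDF (removeEdge (adj G) u v) h → k < weight h
ERCritical⇒γtR<weight G noIsolated critical {k} {u} {v} {h} γ auv u-other v-other th
  with critical u v auv | u-other | v-other
... | inj₁ (inj₁ du≡1) | (u′ , u′≢v , auu′) | _ =
  contradiction du≡1 (degree≢1 (adj G) u v u′ auv auu′ (u′≢v ∘ sym))
... | inj₁ (inj₂ dv≡1) | _ | (v′ , v′≢u , avv′) =
  contradiction dv≡1 (degree≢1 (adj G) v u v′ (adj-flip G auv) avv′ (v′≢u ∘ sym))
... | inj₂ γ-grows | _ | _ =
  let (k′ , γ′) = γtR-exists (removeEdge (adj G) u v) (removeEdge-NoIsolated noIsolated u-other v-other)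
  in <-≤-trans (γ-grows k k′ γ γ′) (proj₂ γ′ h th)

-- Centres of spiders

NotAlone : ∀ {n} → Adj n → Fin n → Fin n → Set
NotAlone a x c = ∀ p → a x p ≡ true → p ≢ c → ∃ λ q → q ≢ p × a x q ≡ true × q ≢ c

record SpiderCentre {n} (a : Adj n) (c : Fin n) : Set where
  field
    leaves-independent : ∀ {x y} → a c x ≡ true → a c y ≡ true → a x y ≡ true → ⊥
    pendant-neighbour  : ∀ {x p} → a c x ≡ true → a x p ≡ true → p ≢ c →
                         ∀ z → a p z ≡ true → z ≡ x
    leaf-not-alone     : ∀ {x} → a c x ≡ true → NotAlone a x c

module _ {n} (a : Adj n) (x c : Fin n) where

  NotAlone? : Dec (NotAlone a x c)
  NotAlone? = all? λ p → (a x p ≟ᵇ true) →-dec (≢? p c →-dec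
                any? λ q → ≢? q p ×-dec ((a x q ≟ᵇ true) ×-dec ≢? q c))

  ¬NotAlone⇒lone : ¬ NotAlone a x c →
    ∃ λ p → a x p ≡ true × p ≢ c × (∀ q → a x q ≡ true → q ≢ c → q ≡ p)
  ¬NotAlone⇒lone ¬notAlone with ¬∀⟶∃¬ n _ (λ p → (a x p ≟ᵇ true) →-dec (≢? p c →-dec
                                   any? λ q → ≢? q p ×-dec ((a x q ≟ᵇ true) ×-dec ≢? q c))) ¬notAlone
  ... | p , ¬partner with a x p ≟ᵇ true | p ≟ᶠ c
  ... | no ¬axp | _       = contradiction (λ axp → contradiction axp ¬axp) ¬partner
  ... | yes _   | yes p≡c = contradiction (λ _ p≢c → contradiction p≡c p≢c) ¬partner
  ... | yes axp | no p≢c  =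
    p , axp , p≢c , λ q axq q≢c → ¬∃-other⇒≡ p (λ other → ¬partner (λ _ _ → other)) q (axq , q≢c)

-- A minimum total Roman dominating function of an ER-critical graph

module MinimumTRDF (G : Graph) (noIsolated : NoIsolated (adj G)) (critical : ERCritical G)
                   {k : ℕ} (γ : IsγtR (adj G) k) where

  a : Adj (V G)
  a = adj G

  f : Fin (V G) → Fin 3
  f = proj₁ (proj₁ γ)

  f-TRDF : IsTRDF a f
  f-TRDF = proj₁ (proj₂ (proj₁ γ))

  f-weight : weight f ≡ k
  f-weight = proj₂ (proj₂ (proj₁ γ))

  open Serving a f

  Zero Positive Two : Fin (V G) → Set
  Zero x     = toℕ (f x) ≡ 0
  Positive x = 0 < toℕ (f x)
  Two x      = toℕ (f x) ≡ 2

  not-lighter : ∀ {u v h} → a u v ≡ true → OtherNeighbour a u v → OtherNeighbour a v u →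
    IsTRDF (removeEdge a u v) h → weight h ≡ weight f → ⊥
  not-lighter auv u-other v-other th h≡f =
    <-irrefl (trans (sym f-weight) (sym h≡f))
      (ERCritical⇒γtR<weight G noIsolated critical γ auv u-other v-other th)

  no-redundant-edge : ∀ {u v} → a u v ≡ true → ServedWithout a f u v → ServedWithout a f v u → ⊥
  no-redundant-edge auv su sv =
    not-lighter auv (ServedWithout⇒OtherNeighbour su) (ServedWithout⇒OtherNeighbour sv)
      (IsTRDF-removeEdge f-TRDF su sv) refl

  zero⇒unique-neighbour : ∀ {u} → Zero u →
    ∃ λ v → a u v ≡ true × Two v × (∀ w → a u w ≡ true → w ≡ v)
  zero⇒unique-neighbour {u} fu≡0 =
    let (v , auv , fv≡2) = proj₁ f-TRDF u fu≡0
    in v , auv , fv≡2 , ¬∃-other⇒≡ v λ (w , w≢v , auw) →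
         no-redundant-edge auw (served-by-two fu≡0 (w≢v ∘ sym) auv fv≡2)
                               (served-avoiding-zero f-TRDF fu≡0 w)

  zero-neighbour : ∀ {c x} → a c x ≡ true → Zero x → ∀ z → a x z ≡ true → z ≡ c
  zero-neighbour acx fx≡0 z axz =
    let (_ , _ , _ , unique) = zero⇒unique-neighbour fx≡0
    in trans (unique z axz) (sym (unique _ (adj-flip G acx)))

  OnlyPositiveNeighbour : Fin (V G) → Fin (V G) → Set
  OnlyPositiveNeighbour x y = ∀ z → a x z ≡ true → Positive z → z ≡ y

  AnotherPositiveNeighbour : Fin (V G) → Fin (V G) → Set
  AnotherPositiveNeighbour x y = ∃ λ z → z ≢ y × (a x z ≡ true × Positive z)

  AnotherPositiveNeighbour? : ∀ x y → Dec (AnotherPositiveNeighbour x y)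
  AnotherPositiveNeighbour? x y = any? λ z → ≢? z y ×-dec ((a x z ≟ᵇ true) ×-dec (0 <? toℕ (f z)))

  ¬another⇒only : ∀ {x y} → ¬ AnotherPositiveNeighbour x y → OnlyPositiveNeighbour x y
  ¬another⇒only {y = y} ¬another z axz fz>0 = ¬∃-other⇒≡ y ¬another z (axz , fz>0)

  positive-edge : ∀ {x y} → a x y ≡ true → Positive x → Positive y →
    OnlyPositiveNeighbour x y ⊎ OnlyPositiveNeighbour y x
  positive-edge {x} {y} axy fx>0 fy>0 with AnotherPositiveNeighbour? x y | AnotherPositiveNeighbour? y x
  ... | no ¬x-other | _ = inj₁ (¬another⇒only ¬x-other)
  ... | yes _ | no ¬y-other = inj₂ (¬another⇒only ¬y-other)
  ... | yes (z , z≢y , axz , fz>0) | yes (z′ , z′≢x , ayz′ , fz′>0) =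
    ⊥-elim (no-redundant-edge axy (served-by-positive fx>0 z≢y axz fz>0)
                                  (served-by-positive fy>0 z′≢x ayz′ fz′>0))

  CentreLike : Fin (V G) → Set
  CentreLike c = ∀ {x} → a c x ≡ true → Positive x → OnlyPositiveNeighbour x c

  beyond-centre : ∀ {c x p} → CentreLike c → a c x ≡ true → a x p ≡ true → p ≢ c →
    Positive x × Zero p
  beyond-centre {c} {x} {p} centreLike acx axp p≢c with value-cases (f x)
  ... | inj₁ fx≡0 = ⊥-elim (p≢c (zero-neighbour acx fx≡0 p axp))
  ... | inj₂ fx>0 with value-cases (f p)
  ...   | inj₁ fp≡0 = fx>0 , fp≡0
  ...   | inj₂ fp>0 = ⊥-elim (p≢c (centreLike acx fx>0 p axp fp>0))

  CentreLike⇒SpiderCentre : ∀ {c} → CentreLike c → (∀ {x} → a c x ≡ true → NotAlone a x c) →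
    SpiderCentre a c
  CentreLike⇒SpiderCentre {c} centreLike notAlone = record
    { leaves-independent = independent
    ; pendant-neighbour  = λ acx axp p≢c → zero-neighbour axp (proj₂ (beyond-centre centreLike acx axp p≢c))
    ; leaf-not-alone     = notAlone
    }
    where
    independent : ∀ {x y} → a c x ≡ true → a c y ≡ true → a x y ≡ true → ⊥
    independent {x} {y} acx acy axy with value-cases (f x) | value-cases (f y)
    ... | inj₁ fx≡0 | _         = adj⇒≢ G acy (sym (zero-neighbour acx fx≡0 y axy))
    ... | inj₂ _    | inj₁ fy≡0 = adj⇒≢ G acx (sym (zero-neighbour acy fy≡0 x (adj-flip G axy)))
    ... | inj₂ fx>0 | inj₂ fy>0 = adj⇒≢ G acy (sym (centreLike acx fx>0 y axy fy>0))

  -- Levelling x and p to 1, 1 would give a total Roman dominating function of G - cx of weight γ.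
  lone-pendant : ∀ {c x p y} → Positive c → a c x ≡ true → a x p ≡ true → p ≢ c → Two x → Zero p →
    (∀ q → a x q ≡ true → q ≢ c → q ≡ p) → a c y ≡ true → y ≢ x → Positive y → ⊥
  lone-pendant {c} {x} {p} {y} fc>0 acx axp p≢c fx≡2 fp≡0 x-lone acy y≢x fy>0 =
    not-lighter acx (y , y≢x , acy) (p , p≢c , axp) (dominated , paired)
      (weight-level f x p fx≡2 fp≡0 p≢x)
    where
    h = level f x p
    a′ = removeEdge a c x
    p≢x : p ≢ x
    p≢x = adj⇒≢ G axp ∘ sym
    c≢x : c ≢ x
    c≢x = adj⇒≢ G acx
    dominated : ∀ v → toℕ (h v) ≡ 0 → ∃ λ u → a′ v u ≡ true × toℕ (h u) ≡ 2
    dominated v hv≡0 =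
      let (v≢x , v≢p) = level-zero f v hv≡0
          fv≡0 = trans (cong toℕ (sym (level-elsewhere f v v≢x v≢p))) hv≡0
          (u , avu , fu≡2 , _) = zero⇒unique-neighbour fv≡0
          v≢c : v ≢ c
          v≢c = λ { refl → <-irrefl (sym fv≡0) fc>0 }
          u≢x : u ≢ x
          u≢x = λ u≡x → v≢p (x-lone v (subst (λ z → a z v ≡ true) u≡x (adj-flip G avu)) v≢c)
          u≢p : u ≢ p
          u≢p = λ u≡p → <-irrefl (sym fp≡0) (≡2⇒>0 (subst Two u≡p fu≡2))
      in u , removeEdge-keeps-off a c x v u avu v≢c v≢x
           , trans (cong toℕ (level-elsewhere f u u≢x u≢p)) fu≡2
    paired : ∀ v → 0 < toℕ (h v) → ∃ λ u → a′ v u ≡ true × 0 < toℕ (h u)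
    paired v hv>0 = by-cases (v ≟ᶠ x) (v ≟ᶠ p) (v ≟ᶠ c)
      where
      by-cases : Dec (v ≡ x) → Dec (v ≡ p) → Dec (v ≡ c) →
        ∃ λ u → a′ v u ≡ true × 0 < toℕ (h u)
      by-cases (yes refl) _ _ =
        p , removeEdge-keeps a c x x p axp (c≢x ∘ sym ∘ proj₁) (p≢c ∘ proj₂) , level-positiveʳ f x p
      by-cases (no _) (yes refl) _ =
        x , removeEdge-keeps-off a c x p x (adj-flip G axp) p≢c p≢x , level-positiveˡ f x p
      by-cases (no _) (no _) (yes refl) =
        y , removeEdge-keeps a c x c y acy (y≢x ∘ proj₂) (c≢x ∘ proj₁) , level-positive f x p y fy>0
      by-cases (no v≢x) (no v≢p) (no v≢c) =
        let fv>0 = subst (λ d → 0 < toℕ d) (level-elsewhere f v v≢x v≢p) hv>0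
            (w , avw , fw>0) = proj₂ f-TRDF v fv>0
        in w , removeEdge-keeps-off a c x v w avw v≢c v≢x , level-positive f x p w fw>0

  leaves-not-alone : ∀ {c} → Positive c → CentreLike c →
    (∀ {x} → a c x ≡ true → Positive x → ∃ λ y → a c y ≡ true × y ≢ x × Positive y) →
    ∀ {x} → a c x ≡ true → NotAlone a x c
  leaves-not-alone {c} fc>0 centreLike another {x} acx p axp p≢c
    with any? (λ q → ≢? q p ×-dec ((a x q ≟ᵇ true) ×-dec ≢? q c))
  ... | yes (q , q≢p , axq , q≢c) = q , q≢p , axq , q≢c
  ... | no ¬other =
    let (fx>0 , fp≡0) = beyond-centre centreLike acx axp p≢c
        (y , acy , y≢x , fy>0) = another acx fx>0
        (_ , _ , fv≡2 , unique) = zero⇒unique-neighbour fp≡0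
        fx≡2 = subst Two (sym (unique x (adj-flip G axp))) fv≡2
    in ⊥-elim (lone-pendant fc>0 acx axp p≢c fx≡2 fp≡0
                 (λ q axq q≢c → ¬∃-other⇒≡ p ¬other q (axq , q≢c)) acy y≢x fy>0)

  two-positive-neighbours⇒SpiderCentre : ∀ {c y₁ y₂} → Positive c →
    a c y₁ ≡ true → a c y₂ ≡ true → Positive y₁ → Positive y₂ → y₁ ≢ y₂ → SpiderCentre a c
  two-positive-neighbours⇒SpiderCentre {c} {y₁} {y₂} fc>0 acy₁ acy₂ fy₁>0 fy₂>0 y₁≢y₂ =
    CentreLike⇒SpiderCentre centreLike (leaves-not-alone fc>0 centreLike another)
    where
    centreLike : CentreLike c
    centreLike acx fx>0 with positive-edge acx fc>0 fx>0
    ... | inj₁ c-only = contradiction (trans (c-only y₁ acy₁ fy₁>0) (sym (c-only y₂ acy₂ fy₂>0))) y₁≢y₂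
    ... | inj₂ x-only = x-only
    another : ∀ {x} → a c x ≡ true → Positive x → ∃ λ y → a c y ≡ true × y ≢ x × Positive y
    another {x} _ _ with y₁ ≟ᶠ x
    ... | yes y₁≡x = y₂ , acy₂ , (λ y₂≡x → y₁≢y₂ (trans y₁≡x (sym y₂≡x))) , fy₂>0
    ... | no y₁≢x  = y₁ , acy₁ , y₁≢x , fy₁>0

  mutual-edge⇒SpiderCentre : ∀ {A B} → OnlyPositiveNeighbour A B → OnlyPositiveNeighbour B A →
    NotAlone a A B → SpiderCentre a B
  mutual-edge⇒SpiderCentre {A} {B} A-only B-only A-notAlone =
    CentreLike⇒SpiderCentre centreLike notAlone
    where
    centreLike : CentreLike B
    centreLike aBx fx>0 = subst (λ z → OnlyPositiveNeighbour z B) (sym (B-only _ aBx fx>0)) A-only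
    notAlone : ∀ {x} → a B x ≡ true → NotAlone a x B
    notAlone aBx p axp p≢B =
      let x≡A = B-only _ aBx (proj₁ (beyond-centre centreLike aBx axp p≢B))
      in subst (λ z → NotAlone a z B) (sym x≡A) A-notAlone p axp p≢B

  other-neighbour-zero : ∀ {x y q} → OnlyPositiveNeighbour x y → a x q ≡ true → q ≢ y → Zero q × Two x
  other-neighbour-zero {x} x-only axq q≢y with value-cases (f _)
  ... | inj₂ fq>0 = ⊥-elim (q≢y (x-only _ axq fq>0))
  ... | inj₁ fq≡0 =
    let (_ , _ , fv≡2 , unique) = zero⇒unique-neighbour fq≡0
    in fq≡0 , subst Two (sym (unique x (adj-flip G axq))) fv≡2

  -- Levelling both A, p and B, p′ to 1, 1 would give a total Roman dominating function of G - AB of weight γ.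
  not-P4 : ∀ {A B p p′} → a A B ≡ true → OnlyPositiveNeighbour A B → OnlyPositiveNeighbour B A →
    a A p ≡ true → p ≢ B → (∀ q → a A q ≡ true → q ≢ B → q ≡ p) →
    a B p′ ≡ true → p′ ≢ A → (∀ q → a B q ≡ true → q ≢ A → q ≡ p′) → ⊥
  not-P4 {A} {B} {p} {p′} aAB A-only B-only aAp p≢B A-lone aBp′ p′≢A B-lone =
    not-lighter aAB (p , p≢B , aAp) (p′ , p′≢A , aBp′) (dominated , paired) h-weight
    where
    fp≡0 = proj₁ (other-neighbour-zero A-only aAp p≢B)
    fA≡2 = proj₂ (other-neighbour-zero A-only aAp p≢B)
    fp′≡0 = proj₁ (other-neighbour-zero B-only aBp′ p′≢A)
    fB≡2 = proj₂ (other-neighbour-zero B-only aBp′ p′≢A)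
    A≢B : A ≢ B
    A≢B = adj⇒≢ G aAB
    p≢A : p ≢ A
    p≢A = adj⇒≢ G aAp ∘ sym
    p′≢B : p′ ≢ B
    p′≢B = adj⇒≢ G aBp′ ∘ sym
    p≢p′ : p ≢ p′
    p≢p′ refl = let (_ , _ , _ , unique) = zero⇒unique-neighbour fp≡0
                in A≢B (trans (unique A (adj-flip G aAp)) (sym (unique B (adj-flip G aBp′))))
    h₁ = level f A p
    h = level h₁ B p′
    h-elsewhere : ∀ v → v ≢ A → v ≢ p → v ≢ B → v ≢ p′ → h v ≡ f v
    h-elsewhere v v≢A v≢p v≢B v≢p′ =
      trans (level-elsewhere h₁ v v≢B v≢p′) (level-elsewhere f v v≢A v≢p)
    h-positive : ∀ v → Positive v → 0 < toℕ (h v)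
    h-positive v = level-positive h₁ B p′ v ∘ level-positive f A p v
    h-weight : weight h ≡ weight f
    h-weight = trans
      (weight-level h₁ B p′ (trans (cong toℕ (level-elsewhere f B (A≢B ∘ sym) (p≢B ∘ sym))) fB≡2)
                            (trans (cong toℕ (level-elsewhere f p′ p′≢A (p≢p′ ∘ sym))) fp′≡0) p′≢B)
      (weight-level f A p fA≡2 fp≡0 p≢A)
    a′ = removeEdge a A B
    dominated : ∀ v → toℕ (h v) ≡ 0 → ∃ λ u → a′ v u ≡ true × toℕ (h u) ≡ 2
    dominated v hv≡0 =
      let (v≢B , v≢p′) = level-zero h₁ v hv≡0
          (v≢A , v≢p) = level-zero f v (trans (cong toℕ (sym (level-elsewhere h₁ v v≢B v≢p′))) hv≡0)
          fv≡0 = trans (cong toℕ (sym (h-elsewhere v v≢A v≢p v≢B v≢p′))) hv≡0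
          (u , avu , fu≡2 , _) = zero⇒unique-neighbour fv≡0
          u-not-zero : ∀ {q} → Zero q → u ≢ q
          u-not-zero fq≡0 u≡q = <-irrefl (sym fq≡0) (≡2⇒>0 (subst Two u≡q fu≡2))
          u≢A : u ≢ A
          u≢A u≡A = v≢p (A-lone v (subst (λ z → a z v ≡ true) u≡A (adj-flip G avu)) v≢B)
          u≢B : u ≢ B
          u≢B u≡B = v≢p′ (B-lone v (subst (λ z → a z v ≡ true) u≡B (adj-flip G avu)) v≢A)
      in u , removeEdge-keeps-off a A B v u avu v≢A v≢B
           , trans (cong toℕ (h-elsewhere u u≢A (u-not-zero fp≡0) u≢B (u-not-zero fp′≡0))) fu≡2
    paired : ∀ v → 0 < toℕ (h v) → ∃ λ u → a′ v u ≡ true × 0 < toℕ (h u)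
    paired v hv>0 = by-cases (v ≟ᶠ A) (v ≟ᶠ B) (v ≟ᶠ p) (v ≟ᶠ p′)
      where
      by-cases : Dec (v ≡ A) → Dec (v ≡ B) → Dec (v ≡ p) → Dec (v ≡ p′) →
        ∃ λ u → a′ v u ≡ true × 0 < toℕ (h u)
      by-cases (yes refl) _ _ _ =
        p , removeEdge-keeps a A B A p aAp (p≢B ∘ proj₂) (A≢B ∘ proj₁)
          , level-positive h₁ B p′ p (level-positiveʳ f A p)
      by-cases (no _) (yes refl) _ _ =
        p′ , removeEdge-keeps a A B B p′ aBp′ (A≢B ∘ sym ∘ proj₁) (p′≢A ∘ proj₂)
           , level-positiveʳ h₁ B p′
      by-cases (no _) (no _) (yes refl) _ =
        A , removeEdge-keeps-off a A B p A (adj-flip G aAp) p≢A p≢B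
          , level-positive h₁ B p′ A (level-positiveˡ f A p)
      by-cases (no _) (no _) (no _) (yes refl) =
        B , removeEdge-keeps-off a A B p′ B (adj-flip G aBp′) p′≢A p′≢B , level-positiveˡ h₁ B p′
      by-cases (no v≢A) (no v≢B) (no v≢p) (no v≢p′) =
        let fv>0 = subst (λ d → 0 < toℕ d) (h-elsewhere v v≢A v≢p v≢B v≢p′) hv>0
            (w , avw , fw>0) = proj₂ f-TRDF v fv>0
        in w , removeEdge-keeps-off a A B v w avw v≢A v≢B , h-positive w fw>0

  mutual-edge⇒centre : ∀ {A B} → a A B ≡ true → OnlyPositiveNeighbour A B → OnlyPositiveNeighbour B A →
    ∃ (SpiderCentre a)
  mutual-edge⇒centre {A} {B} aAB A-only B-only with NotAlone? a A B | NotAlone? a B A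
  ... | yes A-notAlone | _ = B , mutual-edge⇒SpiderCentre A-only B-only A-notAlone
  ... | no _ | yes B-notAlone = A , mutual-edge⇒SpiderCentre B-only A-only B-notAlone
  ... | no ¬A-notAlone | no ¬B-notAlone =
    let (p , aAp , p≢B , A-lone) = ¬NotAlone⇒lone a A B ¬A-notAlone
        (p′ , aBp′ , p′≢A , B-lone) = ¬NotAlone⇒lone a B A ¬B-notAlone
    in ⊥-elim (not-P4 aAB A-only B-only aAp p≢B A-lone aBp′ p′≢A B-lone)

  spider-centre : 0 < V G → ∃ (SpiderCentre a)
  spider-centre V>0 = from-positive (proj₂ start)
    where
    start : ∃ Positive
    start with value-cases (f (F.fromℕ< V>0))
    ... | inj₂ fv>0 = _ , fv>0
    ... | inj₁ fv≡0 = let (u , _ , fu≡2 , _) = zero⇒unique-neighbour fv≡0 in u , ≡2⇒>0 fu≡2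
    from-positive : ∀ {A} → Positive A → ∃ (SpiderCentre a)
    from-positive {A} fA>0 with proj₂ f-TRDF A fA>0
    ... | B , aAB , fB>0 with AnotherPositiveNeighbour? A B | AnotherPositiveNeighbour? B A
    ... | yes (y , y≢B , aAy , fy>0) | _ =
      A , two-positive-neighbours⇒SpiderCentre fA>0 aAB aAy fB>0 fy>0 (y≢B ∘ sym)
    ... | no _ | yes (y , y≢A , aBy , fy>0) =
      B , two-positive-neighbours⇒SpiderCentre fB>0 (adj-flip G aAB) aBy fA>0 fy>0 (y≢A ∘ sym)
    ... | no ¬A-other | no ¬B-other =
      mutual-edge⇒centre aAB (¬another⇒only ¬A-other) (¬another⇒only ¬B-other)

-- The spider around a centre

lookup-injective : ∀ {A : Set} {xs : List A} → Unique xs → ∀ i j → lookup xs i ≡ lookup xs j → i ≡ j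
lookup-injective (_ ∷ _)   F.zero    F.zero    _ = refl
lookup-injective (x∉ ∷ _)  F.zero    (F.suc j) e = contradiction e (All.lookup x∉ (∈-lookup j))
lookup-injective (x∉ ∷ _)  (F.suc i) F.zero    e = contradiction (sym e) (All.lookup x∉ (∈-lookup i))
lookup-injective (_ ∷ xs!) (F.suc i) (F.suc j) e = cong F.suc (lookup-injective xs! i j e)

module SpiderAround (G : Graph) (connected : Connected (adj G)) (noIsolated : NoIsolated (adj G))
                    {c : Fin (V G)} (centre′ : SpiderCentre (adj G) c) where

  open SpiderCentre centre′

  a : Adj (V G)
  a = adj G

  pendant? : ∀ x p → Dec (a x p ≡ true × p ≢ c)
  pendant? x p = (a x p ≟ᵇ true) ×-dec ≢? p c

  pendants : Fin (V G) → List (Fin (V G))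
  pendants x = filter (pendant? x) (allFin (V G))

  pendants⁻ : ∀ {x p} → p ∈ pendants x → a x p ≡ true × p ≢ c
  pendants⁻ {x} p∈ = proj₂ (∈-filter⁻ (pendant? x) {xs = allFin _} p∈)

  pendants⁺ : ∀ {x p} → a x p ≡ true → p ≢ c → p ∈ pendants x
  pendants⁺ {x} {p} axp p≢c = ∈-filter⁺ (pendant? x) (∈-allFin p) (axp , p≢c)

  pendants-unique : ∀ x → Unique (pendants x)
  pendants-unique x = Unique.filter⁺ (pendant? x) (Unique.allFin⁺ (V G))

  byPendants : DecTotalOrder _ _ _
  byPendants = On.decTotalOrder (Flip.decTotalOrder ≤-decTotalOrder) (length ∘ pendants)

  open Sort byPendants using (sort; sort-↭; sort-↗)

  leg? : ∀ x → Dec (a c x ≡ true)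
  leg? x = a c x ≟ᵇ true

  neighbours : List (Fin (V G))
  neighbours = filter leg? (allFin (V G))

  legs : List (Fin (V G))
  legs = sort neighbours

  n : ℕ
  n = length legs

  leafAt : Fin n → Fin (V G)
  leafAt = lookup legs

  k : Fin n → ℕ
  k i = length (pendants (leafAt i))

  pendantAt : (i : Fin n) → Fin (k i) → Fin (V G)
  pendantAt i = lookup (pendants (leafAt i))

  legs⁻ : ∀ {x} → x ∈ legs → a c x ≡ true
  legs⁻ x∈ = proj₂ (∈-filter⁻ leg? {xs = allFin _} (∈-resp-↭ (sort-↭ neighbours) x∈))

  legs⁺ : ∀ {x} → a c x ≡ true → x ∈ legs
  legs⁺ {x} acx = ∈-resp-↭ (↭-sym (sort-↭ neighbours)) (∈-filter⁺ leg? (∈-allFin x) acx)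

  legs-unique : Unique legs
  legs-unique = Permutationₛ.Unique-resp-↭ (setoid _) (↭⇒↭ₛ (↭-sym (sort-↭ neighbours)))
                  (Unique.filter⁺ leg? (Unique.allFin⁺ (V G)))

  leaf-adj : ∀ i → a c (leafAt i) ≡ true
  leaf-adj i = legs⁻ (∈-lookup i)

  pendant-adj : ∀ i j → a (leafAt i) (pendantAt i j) ≡ true
  pendant-adj i j = proj₁ (pendants⁻ (∈-lookup j))

  pendant≢c : ∀ i j → pendantAt i j ≢ c
  pendant≢c i j = proj₂ (pendants⁻ (∈-lookup j))

  k-antitone : ∀ (i j : Fin n) → i F.≤ j → k j ≤ k i
  k-antitone i j = Sorted.lookup-mono-≤ (DecTotalOrder.totalOrder byPendants) (sort-↗ neighbours)

  k≢1 : ∀ i → k i ≢ 1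
  k≢1 i k≡1 with pendants (leafAt i) in eq
  k≢1 i ()  | []
  k≢1 i ()  | _ ∷ _ ∷ _
  k≢1 i k≡1 | p ∷ [] =
    let (ap , p≢c) = pendants⁻ (subst (p ∈_) (sym eq) (here refl))
        (q , q≢p , aq , q≢c) = leaf-not-alone (leaf-adj i) p ap p≢c
    in q≢p (single (subst (q ∈_) eq (pendants⁺ aq q≢c)))
    where
    single : ∀ {q} → q ∈ p ∷ [] → q ≡ p
    single (here q≡p) = q≡p

  n≥1 : 1 ≤ n
  n≥1 = nonempty (legs⁺ (proj₂ (noIsolated c)))
    where
    nonempty : ∀ {x} {xs : List (Fin (V G))} → x ∈ xs → 1 ≤ length xs
    nonempty (here _)  = s≤s z≤n
    nonempty (there _) = s≤s z≤n

  pendantAt-neighbour : ∀ i j z → a (pendantAt i j) z ≡ true → z ≡ leafAt i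
  pendantAt-neighbour i j = pendant-neighbour (leaf-adj i) (pendant-adj i j) (pendant≢c i j)

  pendant-not-leg : ∀ i j → a c (pendantAt i j) ≡ true → ⊥
  pendant-not-leg i j acp = leaves-independent (leaf-adj i) acp (pendant-adj i j)

  leafAt-injective : ∀ i i′ → leafAt i ≡ leafAt i′ → i ≡ i′
  leafAt-injective = lookup-injective legs-unique

  WithinTwo : Fin (V G) → Set
  WithinTwo v = v ≡ c ⊎ a c v ≡ true ⊎ ∃ λ x → a c x ≡ true × a x v ≡ true

  within-two : ∀ v → WithinTwo v
  within-two v = closed (connected c v) (inj₁ refl)
    where
    step : ∀ {x y} → WithinTwo x → a x y ≡ true → WithinTwo y
    step (inj₁ refl) axy = inj₂ (inj₁ axy)
    step {x} {y} (inj₂ (inj₁ acx)) axy with y ≟ᶠ c | a c y ≟ᵇ true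
    ... | yes y≡c | _        = inj₁ y≡c
    ... | no _    | yes acy  = inj₂ (inj₁ acy)
    ... | no _    | no _     = inj₂ (inj₂ (x , acx , axy))
    step {x} (inj₂ (inj₂ (w , acw , awx))) axy with x ≟ᶠ c
    ... | yes refl = inj₂ (inj₁ axy)
    ... | no x≢c   = inj₂ (inj₁ (subst (λ z → a c z ≡ true) (sym (pendant-neighbour acw awx x≢c _ axy))
                                       acw))
    closed : ∀ {x v} → Star (λ x y → a x y ≡ true) x v → WithinTwo x → WithinTwo v
    closed ε          w = w
    closed (axy ◅ xv) w = closed xv (step w axy)

  vertex : SpV n k → Fin (V G)
  vertex centre        = c
  vertex (leaf i)      = leafAt i
  vertex (pendant i j) = pendantAt i j

  locate : ∀ v → ∃ λ s → vertex s ≡ v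
  locate v with v ≟ᶠ c | a c v ≟ᵇ true
  ... | yes v≡c | _     = centre , sym v≡c
  ... | no _    | yes acv = let v∈ = legs⁺ acv in leaf (index v∈) , sym (lookup-index v∈)
  ... | no v≢c  | no ¬acv with within-two v
  ...   | inj₁ v≡c                = contradiction v≡c v≢c
  ...   | inj₂ (inj₁ acv)         = contradiction acv ¬acv
  ...   | inj₂ (inj₂ (x , acx , axv)) =
    let x∈ = legs⁺ acx
        v∈ = subst (λ z → v ∈ pendants z) (lookup-index x∈) (pendants⁺ axv v≢c)
    in pendant (index x∈) (index v∈) , sym (lookup-index v∈)

  vertex-injective : ∀ s t → vertex s ≡ vertex t → s ≡ t
  vertex-injective centre        centre         e = refl
  vertex-injective centre        (leaf i)       e = ⊥-elim (adj⇒≢ G (leaf-adj i) e)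
  vertex-injective centre        (pendant i j)  e = ⊥-elim (pendant≢c i j (sym e))
  vertex-injective (leaf i)      centre         e = ⊥-elim (adj⇒≢ G (leaf-adj i) (sym e))
  vertex-injective (leaf i)      (leaf i′)      e = cong leaf (leafAt-injective i i′ e)
  vertex-injective (leaf i)      (pendant i′ j) e =
    ⊥-elim (pendant-not-leg i′ j (subst (λ z → a c z ≡ true) e (leaf-adj i)))
  vertex-injective (pendant i j) centre         e = ⊥-elim (pendant≢c i j e)
  vertex-injective (pendant i j) (leaf i′)      e =
    ⊥-elim (pendant-not-leg i j (subst (λ z → a c z ≡ true) (sym e) (leaf-adj i′)))
  vertex-injective (pendant i j) (pendant i′ j′) e
    with leafAt-injective i i′ (pendantAt-neighbour i′ j′ (leafAt i)
           (subst (λ z → a z (leafAt i) ≡ true) e (adj-flip G (pendant-adj i j))))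
  ... | refl = cong (pendant i) (lookup-injective (pendants-unique (leafAt i)) j j′ e)

  vertex-adj : ∀ {s t} → SpAdj s t → a (vertex s) (vertex t) ≡ true
  vertex-adj (c-l i)   = leaf-adj i
  vertex-adj (l-c i)   = adj-flip G (leaf-adj i)
  vertex-adj (l-p i j) = pendant-adj i j
  vertex-adj (p-l i j) = adj-flip G (pendant-adj i j)

  vertex-adj⁻ : ∀ s t → a (vertex s) (vertex t) ≡ true → SpAdj s t
  vertex-adj⁻ centre (leaf i) _ = c-l i
  vertex-adj⁻ (leaf i) centre _ = l-c i
  vertex-adj⁻ (leaf i) (pendant i′ j) e
    with leafAt-injective i i′ (pendantAt-neighbour i′ j _ (adj-flip G e))
  ... | refl = l-p i j
  vertex-adj⁻ (pendant i j) (leaf i′) e with leafAt-injective i′ i (pendantAt-neighbour i j _ e)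
  ... | refl = p-l i j
  vertex-adj⁻ centre centre e = ⊥-elim (adj⇒≢ G e refl)
  vertex-adj⁻ centre (pendant i j) e = ⊥-elim (pendant-not-leg i j e)
  vertex-adj⁻ (leaf i) (leaf i′) e = ⊥-elim (leaves-independent (leaf-adj i) (leaf-adj i′) e)
  vertex-adj⁻ (pendant i j) centre e = ⊥-elim (pendant-not-leg i j (adj-flip G e))
  vertex-adj⁻ (pendant i j) (pendant i′ j′) e =
    ⊥-elim (pendant-not-leg i′ j′
      (subst (λ z → a c z ≡ true) (sym (pendantAt-neighbour i j _ e)) (leaf-adj i)))

  isoSpider : IsoSpider G n k
  isoSpider = iso , λ x y →
      (λ axy → vertex-adj⁻ (to x) (to y)
                 (subst₂ (λ u v → a u v ≡ true) (sym (to-vertex x)) (sym (to-vertex y)) axy))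
    , (λ s → subst₂ (λ u v → a u v ≡ true) (to-vertex x) (to-vertex y) (vertex-adj s))
    where
    to : Fin (V G) → SpV n k
    to = proj₁ ∘ locate
    to-vertex : ∀ v → vertex (to v) ≡ v
    to-vertex = proj₂ ∘ locate
    iso : Fin (V G) ↔ SpV n k
    iso = mk↔ₛ′ to vertex (λ s → vertex-injective _ _ (to-vertex (vertex s))) to-vertex

Spider : Graph → Set
Spider G = ∃[ n ] Σ (Fin n → ℕ) λ k → 1 ≤ n
  × (∀ (i j : Fin n) → i F.≤ j → k j ≤ k i)
  × (∀ (i : Fin n) → ¬ (k i ≡ 1))
  × IsoSpider G n k

ERCritical⇒Spider : (G : Graph) → 0 < V G → Connected (adj G) → NoIsolated (adj G) → ERCritical G →
  Spider G
ERCritical⇒Spider G V>0 connected noIsolated critical =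
  let (_ , γ) = γtR-exists (adj G) noIsolated
      (_ , centre′) = MinimumTRDF.spider-centre G noIsolated critical γ V>0
      open SpiderAround G connected noIsolated centre′
  in n , k , n≥1 , k-antitone , k≢1 , isoSpider

-- Spiders are ER-critical

module _ {n} {k : Fin n → ℕ} where

  SpAdj-centre⁻ : ∀ {t : SpV n k} → SpAdj centre t → ∃ λ j → t ≡ leaf j
  SpAdj-centre⁻ (c-l j) = j , refl

  SpAdj-leaf⁻ : ∀ {i} {t : SpV n k} → SpAdj (leaf i) t → t ≡ centre ⊎ ∃ λ r → t ≡ pendant i r
  SpAdj-leaf⁻ (l-c _)   = inj₁ refl
  SpAdj-leaf⁻ (l-p _ r) = inj₂ (r , refl)

  SpAdj-pendant⁻ : ∀ {i r} {t : SpV n k} → SpAdj (pendant i r) t → t ≡ leaf i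
  SpAdj-pendant⁻ (p-l _ _) = refl

  data OnLeg (i : Fin n) : SpV n k → Set where
    leg-leaf    : OnLeg i (leaf i)
    leg-pendant : ∀ r → OnLeg i (pendant i r)

  onLeg? : ∀ i s → Dec (OnLeg i s)
  onLeg? i centre = no λ ()
  onLeg? i (leaf j) with j ≟ᶠ i
  ... | yes refl = yes leg-leaf
  ... | no j≢i   = no λ { leg-leaf → j≢i refl }
  onLeg? i (pendant j r) with j ≟ᶠ i
  ... | yes refl = yes (leg-pendant r)
  ... | no j≢i   = no λ { (leg-pendant _) → j≢i refl }

  leg-cases : ∀ i (s : SpV n k) → s ≡ leaf i ⊎ (∃ λ r → s ≡ pendant i r) ⊎ ¬ OnLeg i s
  leg-cases i s with onLeg? i s
  ... | yes leg-leaf        = inj₁ refl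
  ... | yes (leg-pendant r) = inj₂ (inj₁ (r , refl))
  ... | no off              = inj₂ (inj₂ off)

  SpAdj-off-leg : ∀ {i s t} → ¬ OnLeg i s → SpAdj s t → (s ≡ centre → t ≢ leaf i) → ¬ OnLeg i t
  SpAdj-off-leg off (c-l j)   not-cut leg-leaf        = not-cut refl refl
  SpAdj-off-leg off (l-c j)   _       ()
  SpAdj-off-leg off (l-p j r) _       (leg-pendant r) = off leg-leaf
  SpAdj-off-leg off (p-l j r) _       leg-leaf        = off (leg-pendant r)

module SpiderIsCritical (G : Graph) {n} {k : Fin n → ℕ} (spider : IsoSpider G n k) where

  a : Adj (V G)
  a = adj G

  to : Fin (V G) → SpV n k
  to = Inverse.to (proj₁ spider)

  from : SpV n k → Fin (V G)
  from = Inverse.from (proj₁ spider)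

  to-from : ∀ s → to (from s) ≡ s
  to-from = Inverse.strictlyInverseˡ (proj₁ spider)

  located : ∀ {x s} → to x ≡ s → x ≡ from s
  located {x} refl = sym (Inverse.strictlyInverseʳ (proj₁ spider) x)

  adj⇒SpAdj : ∀ {x y} → a x y ≡ true → SpAdj (to x) (to y)
  adj⇒SpAdj {x} {y} = proj₁ (proj₂ spider x y)

  SpAdj⇒adj : ∀ {x y} → SpAdj (to x) (to y) → a x y ≡ true
  SpAdj⇒adj {x} {y} = proj₂ (proj₂ spider x y)

  adj-from⇒SpAdj : ∀ {s y} → a (from s) y ≡ true → SpAdj s (to y)
  adj-from⇒SpAdj {s} e = subst (λ s′ → SpAdj s′ _) (to-from s) (adj⇒SpAdj e)

  SpAdj⇒adj-from : ∀ {s t} → SpAdj s t → a (from s) (from t) ≡ true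
  SpAdj⇒adj-from {s} {t} st = SpAdj⇒adj (subst₂ SpAdj (sym (to-from s)) (sym (to-from t)) st)

  pendant-degree : ∀ i r → degree a (from (pendant i r)) ≡ 1
  pendant-degree i r = degree≡1 a _ (from (leaf i)) (SpAdj⇒adj-from (p-l i r))
    λ y e → located (SpAdj-pendant⁻ (adj-from⇒SpAdj e))

  bare-leaf-degree : ∀ i → k i ≡ 0 → degree a (from (leaf i)) ≡ 1
  bare-leaf-degree i k≡0 = degree≡1 a _ (from centre) (SpAdj⇒adj-from (l-c i)) only-centre
    where
    only-centre : ∀ y → a (from (leaf i)) y ≡ true → y ≡ from centre
    only-centre y e with SpAdj-leaf⁻ (adj-from⇒SpAdj e)
    ... | inj₁ y≡c       = located y≡c
    ... | inj₂ (r , _) = contradiction (subst Fin k≡0 r) λ ()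

  module CutLeg (i : Fin n) (b : Adj (V G)) (b⊆a : ∀ {x y} → b x y ≡ true → a x y ≡ true)
                (b-sym : ∀ {x y} → b x y ≡ true → b y x ≡ true)
                (cut : b (from centre) (from (leaf i)) ≡ false) where

    C L : Fin (V G)
    C = from centre
    L = from (leaf i)

    not-cut : ∀ {x y} → b x y ≡ true → to x ≡ centre → to y ≢ leaf i
    not-cut bxy tx≡c ty≡l
      with trans (sym (subst₂ (λ u v → b u v ≡ true) (located tx≡c) (located ty≡l) bxy)) cut
    ... | ()

    b-off-leg : ∀ {x y} → ¬ OnLeg i (to x) → b x y ≡ true → ¬ OnLeg i (to y)
    b-off-leg off bxy = SpAdj-off-leg off (adj⇒SpAdj (b⊆a bxy)) (not-cut bxy)

    leg-neighbour : ∀ {y} → b L y ≡ true → ∃ λ r → y ≡ from (pendant i r)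
    leg-neighbour bLy with SpAdj-leaf⁻ (adj-from⇒SpAdj (b⊆a bLy))
    ... | inj₁ ty≡c       = contradiction (to-from (leaf i)) (not-cut (b-sym bLy) ty≡c)
    ... | inj₂ (r , ty≡p) = r , located ty≡p

    pendant-neighbour : ∀ r {y} → a (from (pendant i r)) y ≡ true → y ≡ L
    pendant-neighbour r e = located (SpAdj-pendant⁻ (adj-from⇒SpAdj e))

    relabel : (Fin (V G) → Fin 3) → Fin (V G) → SpV n k → Fin 3
    relabel g x s with onLeg? i s
    ... | yes leg-leaf        = 2F
    ... | yes (leg-pendant _) = 0F
    ... | no _                = g x

    restored : (Fin (V G) → Fin 3) → Fin (V G) → Fin 3
    restored g x = relabel g x (to x)

    restored-off : ∀ g {x} → ¬ OnLeg i (to x) → restored g x ≡ g x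
    restored-off g {x} = off (to x)
      where
      off : ∀ s → ¬ OnLeg i s → relabel g x s ≡ g x
      off s ¬on with onLeg? i s
      ... | yes on = contradiction on ¬on
      ... | no _   = refl

    restored-leaf : ∀ g {x} → to x ≡ leaf i → restored g x ≡ 2F
    restored-leaf g {x} tx≡l = trans (cong (relabel g x) tx≡l) on-leaf
      where
      on-leaf : relabel g x (leaf i) ≡ 2F
      on-leaf with i ≟ᶠ i
      ... | yes refl = refl
      ... | no i≢i   = contradiction refl i≢i

    restored-pendant : ∀ g {x r} → to x ≡ pendant i r → restored g x ≡ 0F
    restored-pendant g {x} {r} tx≡p = trans (cong (relabel g x) tx≡p) on-pendant
      where
      on-pendant : relabel g x (pendant i r) ≡ 0F
      on-pendant with i ≟ᶠ i
      ... | yes refl = refl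
      ... | no i≢i   = contradiction refl i≢i

    C-off-leg : ¬ OnLeg i (to C)
    C-off-leg on with subst (OnLeg i) (to-from centre) on
    ... | ()

    restored-TRDF : ∀ {g} → IsTRDF b g → 0 < toℕ (g C) → IsTRDF a (restored g)
    restored-TRDF {g} (dom , pair) gC>0 = dominated , paired
      where
      dominated : ∀ v → toℕ (restored g v) ≡ 0 → ∃ λ u → a v u ≡ true × toℕ (restored g u) ≡ 2
      dominated v fv≡0 with leg-cases i (to v)
      ... | inj₁ tv≡l = contradiction (trans (sym fv≡0) (cong toℕ (restored-leaf g tv≡l))) λ ()
      ... | inj₂ (inj₁ (r , tv≡p)) =
        L , SpAdj⇒adj (subst₂ SpAdj (sym tv≡p) (sym (to-from (leaf i))) (p-l i r))
          , cong toℕ (restored-leaf g (to-from (leaf i)))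
      ... | inj₂ (inj₂ off) =
        let (u , bvu , gu≡2) = dom v (trans (cong toℕ (sym (restored-off g off))) fv≡0)
        in u , b⊆a bvu , trans (cong toℕ (restored-off g (b-off-leg off bvu))) gu≡2
      paired : ∀ v → 0 < toℕ (restored g v) → ∃ λ u → a v u ≡ true × 0 < toℕ (restored g u)
      paired v fv>0 with leg-cases i (to v)
      ... | inj₁ tv≡l =
        C , SpAdj⇒adj (subst₂ SpAdj (sym tv≡l) (sym (to-from centre)) (l-c i))
          , subst (λ d → 0 < toℕ d) (sym (restored-off g C-off-leg)) gC>0
      ... | inj₂ (inj₁ (r , tv≡p)) =
        contradiction (subst (λ d → 0 < toℕ d) (restored-pendant g tv≡p) fv>0) λ ()
      ... | inj₂ (inj₂ off) =
        let (u , bvu , gu>0) = pair v (subst (λ d → 0 < toℕ d) (restored-off g off) fv>0)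
        in u , b⊆a bvu , subst (λ d → 0 < toℕ d) (sym (restored-off g (b-off-leg off bvu))) gu>0

    restored-lighter : ∀ {g} → IsTRDF b g → 2 ≤ k i → weight (restored g) < weight g
    restored-lighter {g} (dom , pair) k≥2 = by-value (value-cases₃ (g L))
      where
      open ≤-Reasoning
      g₂ = g [ L ]≔ 2F

      L≢ : ∀ {v} → ¬ OnLeg i (to v) → v ≢ L
      L≢ off refl = off (subst (OnLeg i) (sym (to-from (leaf i))) leg-leaf)

      pendant≢L : ∀ r → from (pendant i r) ≢ L
      pendant≢L r e with trans (sym (to-from (pendant i r))) (trans (cong to e) (to-from (leaf i)))
      ... | ()

      pendant-injective : ∀ {r r′} → from (pendant i r) ≡ from (pendant i r′) → r ≡ r′
      pendant-injective {r} {r′} e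
        with trans (sym (to-from (pendant i r))) (trans (cong to e) (to-from (pendant i r′)))
      ... | refl = refl

      below : ∀ v → restored g v F.≤ g₂ v
      below v with leg-cases i (to v)
      ... | inj₁ tv≡l = subst₂ F._≤_ (sym (restored-leaf g tv≡l))
                          (sym (trans (cong g₂ (located tv≡l)) ([]≔-updates g L 2F))) ≤-refl
      ... | inj₂ (inj₁ (_ , tv≡p)) = subst (F._≤ g₂ v) (sym (restored-pendant g tv≡p)) z≤n
      ... | inj₂ (inj₂ off) =
        subst₂ F._≤_ (sym (restored-off g off)) (sym ([]≔-minimal g 2F v (L≢ off))) ≤-refl

      drop-at : ∀ r → 0 < toℕ (g (from (pendant i r))) →
        restored g (from (pendant i r)) F.< g₂ (from (pendant i r))
      drop-at r gp>0 = subst₂ F._<_ (sym (restored-pendant g (to-from (pendant i r))))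
                        (sym ([]≔-minimal g 2F _ (pendant≢L r))) gp>0

      -- Leaf and pendants of the cut leg carry at least 3 under g, and at most 2 afterwards.
      by-value : toℕ (g L) ≡ 0 ⊎ toℕ (g L) ≡ 1 ⊎ toℕ (g L) ≡ 2 → weight (restored g) < weight g
      by-value (inj₁ gL≡0) =
        let (y , bLy , gy≡2) = dom L gL≡0
            (r , y≡p) = leg-neighbour bLy
            (z , byz , gz>0) = pair y (≡2⇒>0 gy≡2)
            z≡L = pendant-neighbour r (subst (λ w → a w z ≡ true) y≡p (b⊆a byz))
        in contradiction (subst (λ w → 0 < toℕ (g w)) z≡L gz>0) (<-irrefl (sym gL≡0))
      by-value (inj₂ (inj₂ gL≡2)) =
        let (y , bLy , gy>0) = pair L (≡2⇒>0 gL≡2)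
            (r , y≡p) = leg-neighbour bLy
        in begin-strict
          weight (restored g)  <⟨ weight-mono-< _ below (drop-at r (subst (λ w → 0 < toℕ (g w)) y≡p gy>0)) ⟩
          weight g₂            ≡⟨ +-cancelʳ-≡ 2 _ _
                                    (trans (cong (weight g₂ +_) (sym gL≡2)) (weight-[]≔ g L 2F)) ⟩
          weight g             ∎
      by-value (inj₂ (inj₁ gL≡1)) =
        let (r₀ , r₁ , r₀≢r₁) = two-distinct (k i) k≥2
        in ≤-pred (begin-strict
          suc (weight (restored g))  <⟨ weight-mono-<₂ _ _ (r₀≢r₁ ∘ pendant-injective) below
                                          (drop-at r₀ (pendant-positive r₀)) (drop-at r₁ (pendant-positive r₁)) ⟩
          weight g₂                  ≡⟨ +-cancelʳ-≡ 1 _ _ (trans (cong (weight g₂ +_) (sym gL≡1))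
                                          (trans (weight-[]≔ g L 2F) (+-suc (weight g) 1))) ⟩
          suc (weight g)             ∎)
        where
        pendant-positive : ∀ r → 0 < toℕ (g (from (pendant i r)))
        pendant-positive r with value-cases (g (from (pendant i r)))
        ... | inj₂ gp>0 = gp>0
        ... | inj₁ gp≡0 =
          let (z , bpz , gz≡2) = dom _ gp≡0
              gL≡2 = subst (λ w → toℕ (g w) ≡ 2) (pendant-neighbour r (b⊆a bpz)) gz≡2
          in contradiction (trans (sym gL≡1) gL≡2) λ ()

    -- If the centre gets 0, it is dominated by some leaf whose positive partner is one of its pendants;
    -- moving one unit from that pendant to the centre keeps a total Roman dominating function of b.
    centre-positive : ∀ {g} → IsTRDF b g → toℕ (g C) ≡ 0 →
      ∃ λ g′ → IsTRDF b g′ × 0 < toℕ (g′ C) × weight g′ ≤ weight g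
    centre-positive {g} (dom , pair) gC≡0 =
      let (u , bCu , gu≡2) = dom C gC≡0
          (w , buw , gw>0) = pair u (≡2⇒>0 gu≡2)
      in shift bCu gu≡2 buw gw>0
      where
      shift : ∀ {u w} → b C u ≡ true → toℕ (g u) ≡ 2 → b u w ≡ true → 0 < toℕ (g w) →
        ∃ λ g′ → IsTRDF b g′ × 0 < toℕ (g′ C) × weight g′ ≤ weight g
      shift {u} {w} bCu gu≡2 buw gw>0 = g′ , (dominated , paired) , g′C>0 , g′-weight
        where
        C≢w : C ≢ w
        C≢w C≡w = <-irrefl (sym gC≡0) (subst (λ x → 0 < toℕ (g x)) (sym C≡w) gw>0)
        u≢C : u ≢ C
        u≢C = adj⇒≢ G (b⊆a bCu) ∘ sym
        u≢w : u ≢ w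
        u≢w = adj⇒≢ G (b⊆a buw)
        w-leaf : ∀ {y} → a w y ≡ true → y ≡ u
        w-leaf {y} awy with SpAdj-centre⁻ (adj-from⇒SpAdj (b⊆a bCu))
        ... | j , tu≡l with SpAdj-leaf⁻ (subst (λ s → SpAdj s (to w)) tu≡l (adj⇒SpAdj (b⊆a buw)))
        ...   | inj₁ tw≡c = contradiction (sym (located tw≡c)) C≢w
        ...   | inj₂ (_ , tw≡p) =
          trans (located (SpAdj-pendant⁻ (subst (λ s → SpAdj s (to y)) tw≡p (adj⇒SpAdj awy))))
                (sym (located tu≡l))
        g₁ = g [ C ]≔ 1F
        g′ = g₁ [ w ]≔ 0F
        g′-elsewhere : ∀ {v} → v ≢ C → v ≢ w → g′ v ≡ g v
        g′-elsewhere {v} v≢C v≢w = trans ([]≔-minimal g₁ 0F v v≢w) ([]≔-minimal g 1F v v≢C)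
        g′C>0 : 0 < toℕ (g′ C)
        g′C>0 = subst (λ d → 0 < toℕ d) (sym (trans ([]≔-minimal g₁ 0F C C≢w) ([]≔-updates g C 1F)))
                  (s≤s z≤n)
        g′u≡2 : toℕ (g′ u) ≡ 2
        g′u≡2 = trans (cong toℕ (g′-elsewhere u≢C u≢w)) gu≡2
        g′-weight : weight g′ ≤ weight g
        g′-weight = +-cancelʳ-≤ 1 _ _ (begin
          weight g′ + 1             ≤⟨ +-monoʳ-≤ (weight g′)
                                         (subst (λ d → 0 < toℕ d) (sym ([]≔-minimal g 1F w (C≢w ∘ sym))) gw>0) ⟩
          weight g′ + toℕ (g₁ w)    ≡⟨ weight-[]≔ g₁ w 0F ⟩
          weight g₁ + 0             ≡⟨ cong (weight g₁ +_) gC≡0 ⟨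
          weight g₁ + toℕ (g C)     ≡⟨ weight-[]≔ g C 1F ⟩
          weight g + 1              ∎)
          where open ≤-Reasoning
        dominated : ∀ v → toℕ (g′ v) ≡ 0 → ∃ λ y → b v y ≡ true × toℕ (g′ y) ≡ 2
        dominated v g′v≡0 with v ≟ᶠ w
        ... | yes refl = u , b-sym buw , g′u≡2
        ... | no v≢w =
          let v≢C : v ≢ C
              v≢C = λ { refl → <-irrefl (sym g′v≡0) g′C>0 }
              gv≡0 = trans (cong toℕ (sym (g′-elsewhere v≢C v≢w))) g′v≡0
              (y , bvy , gy≡2) = dom v gv≡0
              y≢C : y ≢ C
              y≢C = λ y≡C → <-irrefl (sym gC≡0) (≡2⇒>0 (subst (λ x → toℕ (g x) ≡ 2) y≡C gy≡2))
              y≢w : y ≢ w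
              y≢w = λ y≡w →
                let v≡u = w-leaf (subst (λ x → a x v ≡ true) y≡w (b⊆a (b-sym bvy)))
                in <-irrefl (sym gv≡0) (≡2⇒>0 (subst (λ x → toℕ (g x) ≡ 2) (sym v≡u) gu≡2))
          in y , bvy , trans (cong toℕ (g′-elsewhere y≢C y≢w)) gy≡2
        paired : ∀ v → 0 < toℕ (g′ v) → ∃ λ y → b v y ≡ true × 0 < toℕ (g′ y)
        paired v g′v>0 with v ≟ᶠ C | v ≟ᶠ u
        ... | yes refl | _ = u , bCu , ≡2⇒>0 g′u≡2
        ... | no _ | yes refl = C , b-sym bCu , g′C>0
        ... | no v≢C | no v≢u =
          let v≢w : v ≢ w
              v≢w = λ { refl → <-irrefl (sym (cong toℕ ([]≔-updates g₁ v 0F))) g′v>0 }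
              (y , bvy , gy>0) = pair v (subst (λ d → 0 < toℕ d) (g′-elsewhere v≢C v≢w) g′v>0)
              y≢C : y ≢ C
              y≢C = λ y≡C → <-irrefl (sym gC≡0) (subst (λ x → 0 < toℕ (g x)) y≡C gy>0)
              y≢w : y ≢ w
              y≢w = λ y≡w → v≢u (w-leaf (subst (λ x → a x v ≡ true) y≡w (b⊆a (b-sym bvy))))
          in y , bvy , subst (λ d → 0 < toℕ d) (sym (g′-elsewhere y≢C y≢w)) gy>0

    γtR-grows : 2 ≤ k i → ∀ K K′ → IsγtR a K → IsγtR b K′ → K < K′
    γtR-grows k≥2 K K′ (_ , minimal) ((g , tg , refl) , _) with value-cases (g C)
    ... | inj₂ gC>0 = ≤-<-trans (minimal _ (restored-TRDF tg gC>0)) (restored-lighter tg k≥2)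
    ... | inj₁ gC≡0 =
      let (g′ , tg′ , g′C>0 , g′≤g) = centre-positive tg gC≡0
      in <-≤-trans (≤-<-trans (minimal _ (restored-TRDF tg′ g′C>0)) (restored-lighter tg′ k≥2)) g′≤g

  CriticalEdge : Fin (V G) → Fin (V G) → Set
  CriticalEdge u v = (degree a u ≡ 1 ⊎ degree a v ≡ 1)
    ⊎ (∀ K K′ → IsγtR a K → IsγtR (removeEdge a u v) K′ → K < K′)

  ERCritical-spider : (∀ i → ¬ (k i ≡ 1)) → ERCritical G
  ERCritical-spider k≢1 u v auv =
    subst₂ CriticalEdge (sym (located refl)) (sym (located refl)) (critical-at (adj⇒SpAdj auv))
    where
    cut-leg : ∀ {x y} i → 2 ≤ k i → removeEdge a x y (from centre) (from (leaf i)) ≡ false →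
      ∀ K K′ → IsγtR a K → IsγtR (removeEdge a x y) K′ → K < K′
    cut-leg {x} {y} i k≥2 cut = CutLeg.γtR-grows i (removeEdge a x y)
      (removeEdge-⊆ a x y _ _) (removeEdge-sym a x y (adj-sym G)) cut k≥2
    critical-at : ∀ {s t} → SpAdj s t → CriticalEdge (from s) (from t)
    critical-at (l-p i r) = inj₁ (inj₂ (pendant-degree i r))
    critical-at (p-l i r) = inj₁ (inj₁ (pendant-degree i r))
    critical-at (c-l i) with k i ≟ 0
    ... | yes k≡0 = inj₁ (inj₂ (bare-leaf-degree i k≡0))
    ... | no k≢0  = inj₂ (cut-leg i (≥2 (k i) k≢0 (k≢1 i)) (removeEdge-removes a _ _))
    critical-at (l-c i) with k i ≟ 0
    ... | yes k≡0 = inj₁ (inj₁ (bare-leaf-degree i k≡0))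
    ... | no k≢0  = inj₂ (cut-leg i (≥2 (k i) k≢0 (k≢1 i)) (removeEdge-removes⁻ a _ _))

theorem7p11 : (G : Graph) → 0 < V G → Connected (adj G) → NoIsolated (adj G) →
    ERCritical G ⇔
      (∃[ n ] Σ (Fin n → ℕ) λ k → 1 ≤ n
        × (∀ (i j : Fin n) → i F.≤ j → k j ≤ k i)
        × (∀ (i : Fin n) → ¬ (k i ≡ 1))
        × IsoSpider G n k)
theorem7p11 G V>0 connected noIsolated =
  mk⇔ (ERCritical⇒Spider G V>0 connected noIsolated)
      (λ (_ , _ , _ , _ , k≢1 , iso) → SpiderIsCritical.ERCritical-spider G iso k≢1)
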